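{- Let $\mathcal{L}$ be an abstract intuitionistic logic and let $\mathcal{L}'\in StIL$ be such that $\mathcal{L}$ is preserved under $\mathcal{L}'$-asimulations. Let $\Theta$ be a signature and $(\mathcal{M},w),(\mathcal{N},v)\in Str_\mathcal{L}(\Theta)$. If $n<\omega$, $\bar a_n\in A_w^n$, $\bar b_n\in B_v^n$, and $A$ is an $\mathcal{L}'$-asimulation from $(\mathcal{M},w,\bar a_n)$ to $(\mathcal{N},v,\bar b_n)$, then $Tp^+_\mathcal{L}(\mathcal{M},w,\bar c_n/\bar a_n)\subseteq Tp^+_\mathcal{L}(\mathcal{N},v,\bar c_n/\bar b_n)$ for any tuple $\bar c_n$ of pairwise distinct constants outside $\Theta$.
   Context: A signature $\Theta$ consists of predicate letters of positive arities and individual constants; no function symbols. A (Kripke) $\Theta$-model is $\mathcal{M}=\langle W,\prec,\mathfrak{A},\mathbb{H}\rangle$: $W\neq\emptyset$; $\prec$ a partial order; $\mathfrak{A}_w=(A_w,I_w)$ a classical $\Theta$-structure for each $w$, with pairwise disjoint domains; homomorphisms $\mathbb{H}_{wv}:\mathfrak{A}_w\to\mathfrak{A}_v$ for $w\prec v$ with $\mathbb{H}_{ww}=id$, $\mathbb{H}_{wu}=\mathbb{H}_{vu}\circ\mathbb{H}_{wv}$. $\mathcal{N}$'s domains are $B_v$. $[\mathcal{M},w]$ is the restriction of $\mathcal{M}$ to $\{v:w\prec v\}$; for fresh pairwise distinct constants $\bar c_n$ and $\bar a_n\in A_w^n$, $([\mathcal{M},w],\bar c_n/\bar a_n)$ expands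 it with $c_i$ denoting $\mathbb{H}_{wv}(a_i)$ at $v$. $Tp^+_\mathcal{L}(\mathcal{M},w,\bar c_n/\bar a_n)$ is the set of $\phi\in L(\Theta\cup\{\bar c_n\})$ with $([\mathcal{M},w],\bar c_n/\bar a_n),w\models_\mathcal{L}\phi$. $StIL=\{\mathsf{IL},\mathsf{CD},\mathsf{IL}^\equiv,\mathsf{CD}^\equiv,\mathsf{In}^\equiv,\mathsf{Bi}^\equiv\}$ are the standard intuitionistic first-order logics with Kripke semantics, in the language without equality ($\mathsf{IL},\mathsf{CD}$) or with equality $\equiv$, over respectively: all models; models with all $\mathbb{H}_{wv}$ surjective; all models; surjective; injective; bijective. Asimulations. Fix pairwise distinct constants $c_1,c_2,\dots\notin\Theta$. An $\mathcal{L}'$-asimulation from $(\mathcal{M}_1,w_1,\bar a_n)$ to $(\mathcal{M}_2,w_2,\bar b_n)$ is a relation $A$ between pairs $(w;\bar\alpha_l)$ ($w\in W_i$) and $(v;\bar\beta_l)$ ($v\in W_j$) of equal length, $\{i,j\}=\{1,2\}$, with $(w_1;\bar a_n)A(w_2;\bar b_n)$, such that whenever $(w;\bar\alpha_l)A(v;\bar\beta_l)$ with $\bar\alpha_l\in(A_i)_w^l,\bar\beta_l\in(A_j)_v^l$: atomic sentences of $\mathcal{L}'$ over $\Theta\cup\{c_1..c_l\}$ true at $w$ in $([\mathcal{M}_i,w],\bar c_l/\bar\alpha_l)$ are true at $v$ in $([\mathcal{M}_j,v],\bar c_l/\bar\beta_l)$; if $v\prec_j t$ some $u\succ_i w$ has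 $(u;\mathbb{H}_{wu}\langle\bar\alpha\rangle)A(t;\mathbb{H}_{vt}\langle\bar\beta\rangle)$ and $(t;\mathbb{H}_{vt}\langle\bar\beta\rangle)A(u;\mathbb{H}_{wu}\langle\bar\alpha\rangle)$; each $\alpha'\in(A_i)_w$ has $\beta'\in(A_j)_v$ with $(w;\bar\alpha{}^\frown\alpha')A(v;\bar\beta{}^\frown\beta')$; each $t\succ_j v$ and $\beta'\in(A_j)_t$ have $u\succ_i w$, $\alpha'\in(A_i)_u$ with $(u;\mathbb{H}_{wu}\langle\bar\alpha\rangle^\frown\alpha')A(t;\mathbb{H}_{vt}\langle\bar\beta\rangle^\frown\beta')$. Abstract intuitionistic logics. A quadruple $\mathcal{L}=(Str_\mathcal{L},L,\models_\mathcal{L},\boxplus_\mathcal{L})$ where $Str_\mathcal{L}(\Theta)$ is a class of pointed $\Theta$-models closed under isomorphisms, renamings, change of point, reducts, unions of countable submodel-chains and constant extensions; $L(\Theta)$ a set of sentences; $\models_\mathcal{L}$ its satisfaction; $\boxplus_\mathcal{L}$ selects admissible constant expansions; satisfying Occurrence, Renaming, Isomorphism invariance, Expansion (truth unaffected by reducts), and closure under $\bot,\to,\wedge,\vee,\exists c,\forall c$ with intuitionistic semantics. $\mathcal{L}$ is preserved under $\mathcal{L}'$-asimulations iff for all $(\mathcal{M}_1,w_1),(\mathcal{M}_2,w_2)\in Str_\mathcal{L}(\Theta)$ (any signature $\Theta$), if there is an $\mathcal{L}'$-asimulation from $(\mathcal{M}_1,w_1)$ to $(\mathcal{M}_2,w_2)$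 (empty tuples), then every $\phi\in L(\Theta)$ true at $(\mathcal{M}_1,w_1)$ is true at $(\mathcal{M}_2,w_2)$. -}

module Defs where

open import Data.Nat using (ℕ; zero; suc; _<_)
open import Data.Fin using (Fin)
open import Data.Vec using (Vec; []; _∷_; map; lookup; _∷ʳ_)
open import Data.Sum using (_⊎_; inj₁; inj₂)
open import Data.Product using (Σ; _×_; _,_; ∃; proj₁; proj₂)
open import Data.Empty using (⊥)
open import Data.Bool using (Bool; true; false)
open import Level using (Level)
open import Function.Bundles using (_⇔_)
open import Relation.Binary.PropositionalEquality
  using (_≡_; refl; sym; trans; cong; subst)

Bij : {A B : Set} → (A → B) → Set
Bij {A} {B} f = (∀ {x y} → f x ≡ f y → x ≡ y) × (∀ (y : B) → Σ A λ x → f x ≡ y)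

record Sig : Set₁ where
  field
    Pred      : Set
    arity     : Pred → ℕ
    arity-pos : ∀ P → 0 < arity P
    Const     : Set
open Sig public

-- Θ ∪ {c₁,…,cₙ}: the signature expanded by n fresh, pairwise distinct
-- constants; the constant cᵢ is  inj₂ i.
_⊕_ : Sig → ℕ → Sig
Θ ⊕ n = record
  { Pred = Pred Θ ; arity = arity Θ ; arity-pos = arity-pos Θ
  ; Const = Const Θ ⊎ Fin n }

record SigMor (Θ' Θ : Sig) : Set where
  field
    pmap     : Pred Θ' → Pred Θ
    pmap-ar  : ∀ P → arity Θ (pmap P) ≡ arity Θ' P
    pmap-inj : ∀ {P Q} → pmap P ≡ pmap Q → P ≡ Q
    cmap     : Const Θ' → Const Θ
    cmap-inj : ∀ {c d} → cmap c ≡ cmap d → c ≡ d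
open SigMor public

record Structure (Θ : Sig) : Set₁ where
  field
    Dom : Set
    rel : (P : Pred Θ) → Vec Dom (arity Θ P) → Set
    con : Const Θ → Dom
open Structure public

record IsHom {Θ : Sig} (S T : Structure Θ) (h : Dom S → Dom T) : Set where
  field
    hom-rel : ∀ P (xs : Vec (Dom S) (arity Θ P)) → rel S P xs → rel T P (map h xs)
    hom-con : ∀ c → h (con S c) ≡ con T c
open IsHom public

expS : {Θ : Sig} {l : ℕ} (S : Structure Θ) → Vec (Dom S) l → Structure (Θ ⊕ l)
expS S ᾱ = record
  { Dom = Dom S ; rel = rel S
  ; con = λ { (inj₁ c) → con S c ; (inj₂ i) → lookup ᾱ i } }

-- Domains of distinct worlds are distinct types, so
-- disjointness is automatic.

record Model (Θ : Sig) : Set₁ where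
  field
    W         : Set
    _≺_       : W → W → Set
    ≺-irr     : ∀ {w v} (p q : w ≺ v) → p ≡ q
    ≺-refl    : ∀ {w} → w ≺ w
    ≺-trans   : ∀ {w v u} → w ≺ v → v ≺ u → w ≺ u
    ≺-antisym : ∀ {w v} → w ≺ v → v ≺ w → w ≡ v
    𝔄         : W → Structure Θ
    H         : ∀ {w v} → w ≺ v → Dom (𝔄 w) → Dom (𝔄 v)
    H-hom     : ∀ {w v} (p : w ≺ v) → IsHom (𝔄 w) (𝔄 v) (H p)
    H-id      : ∀ {w} (p : w ≺ w) x → H p x ≡ x
    H-comp    : ∀ {w v u} (p : w ≺ v) (q : v ≺ u) (r : w ≺ u) x →
                H r x ≡ H q (H p x)
open Model public

Dm : {Θ : Sig} (M : Model Θ) → W M → Set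
Dm M w = Dom (𝔄 M w)

-- ([M,w], c̄ₙ/āₙ): restriction to the cone above w, expanded by
-- constants c₁..cₙ with cᵢ denoting H_{wv}(aᵢ) at v.

private
  Σ-≡ : {A : Set} {B : A → Set} (irr : ∀ {a} (p q : B a) → p ≡ q)
        {a a' : A} {b : B a} {b' : B a'} → a ≡ a' → _≡_ {A = Σ A B} (a , b) (a' , b')
  Σ-≡ irr {b = b} {b'} refl = cong (λ z → _ , z) (irr b b')

  map-∘ : {A B C : Set} {n : ℕ} (f : A → B) (g : B → C) (xs : Vec A n) →
          map g (map f xs) ≡ map (λ x → g (f x)) xs
  map-∘ f g [] = refl
  map-∘ f g (x ∷ xs) = cong (g (f x) ∷_) (map-∘ f g xs)

  lookup-map : {A B : Set} {n : ℕ} (f : A → B) (xs : Vec A n) (i : Fin n) →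
               lookup (map f xs) i ≡ f (lookup xs i)
  lookup-map f (x ∷ xs) Fin.zero = refl
  lookup-map f (x ∷ xs) (Fin.suc i) = lookup-map f xs i

expand : {Θ : Sig} {n : ℕ} (M : Model Θ) (w : W M) → Vec (Dm M w) n → Model (Θ ⊕ n)
expand {Θ} {n} M w ā = record
  { W = Σ (W M) (λ v → _≺_ M w v)
  ; _≺_ = λ x y → _≺_ M (proj₁ x) (proj₁ y)
  ; ≺-irr = ≺-irr M
  ; ≺-refl = ≺-refl M
  ; ≺-trans = ≺-trans M
  ; ≺-antisym = λ p q → Σ-≡ (≺-irr M) (≺-antisym M p q)
  ; 𝔄 = S
  ; H = H M
  ; H-hom = λ {x} {y} p → record
      { hom-rel = hom-rel (H-hom M p)
      ; hom-con = λ { (inj₁ c) → hom-con (H-hom M p) c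
                    ; (inj₂ i) → sym (H-comp M (proj₂ x) p (proj₂ y) (lookup ā i)) } }
  ; H-id = H-id M
  ; H-comp = H-comp M
  }
  where
  S : Σ (W M) (λ v → _≺_ M w v) → Structure (Θ ⊕ n)
  S (v , p) = record
    { Dom = Dm M v ; rel = rel (𝔄 M v)
    ; con = λ { (inj₁ c) → con (𝔄 M v) c ; (inj₂ i) → H M p (lookup ā i) } }

base : {Θ : Sig} {n : ℕ} (M : Model Θ) (w : W M) (ā : Vec (Dm M w) n) → W (expand M w ā)
base M w ā = w , ≺-refl M

private
  subst-map : {A B : Set} (h : A → B) {m k : ℕ} (e : m ≡ k) (xs : Vec A m) →
              map h (subst (Vec A) e xs) ≡ subst (Vec B) e (map h xs)
  subst-map h refl xs = refl

reduct : {Θ' Θ : Sig} → SigMor Θ' Θ → Model Θ → Model Θ'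
reduct {Θ'} {Θ} σ M = record
  { W = W M ; _≺_ = _≺_ M ; ≺-irr = ≺-irr M ; ≺-refl = ≺-refl M
  ; ≺-trans = ≺-trans M ; ≺-antisym = ≺-antisym M
  ; 𝔄 = S ; H = H M
  ; H-hom = λ p → record
      { hom-rel = λ P xs r →
          subst (rel (𝔄 M _) (pmap σ P)) (subst-map (H M p) (sym (pmap-ar σ P)) xs)
                (hom-rel (H-hom M p) (pmap σ P) _ r)
      ; hom-con = λ c → hom-con (H-hom M p) (cmap σ c) }
  ; H-id = H-id M ; H-comp = H-comp M }
  where
  S : W M → Structure Θ'
  S v = record
    { Dom = Dm M v
    ; rel = λ P xs → rel (𝔄 M v) (pmap σ P) (subst (Vec (Dm M v)) (sym (pmap-ar σ P)) xs)
    ; con = λ c → con (𝔄 M v) (cmap σ c) }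

record Iso {Θ : Sig} (M N : Model Θ) : Set where
  field
    f       : W M → W N
    f-bij   : Bij f
    f-≺     : ∀ {w v} → _≺_ M w v ⇔ _≺_ N (f w) (f v)
    g       : ∀ w → Dm M w → Dm N (f w)
    g-bij   : ∀ w → Bij (g w)
    g-rel   : ∀ w P (xs : Vec (Dm M w) (arity Θ P)) →
              rel (𝔄 M w) P xs ⇔ rel (𝔄 N (f w)) P (map (g w) xs)
    g-con   : ∀ w c → g w (con (𝔄 M w) c) ≡ con (𝔄 N (f w)) c
    g-H     : ∀ {w v} (p : _≺_ M w v) (q : _≺_ N (f w) (f v)) x →
              g v (H M p x) ≡ H N q (g w x)
open Iso public

-- The standard intuitionistic logics StIL.  For asimulations only the
-- presence of equality in the language matters.

data StIL : Set where
  IL CD ILeq CDeq Ineq Bieq : StIL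

hasEq : StIL → Bool
hasEq IL   = false
hasEq CD   = false
hasEq ILeq = true
hasEq CDeq = true
hasEq Ineq = true
hasEq Bieq = true

data Atom (L' : StIL) (Θ : Sig) : Set where
  atP  : (P : Pred Θ) → Vec (Const Θ) (arity Θ P) → Atom L' Θ
  atEq : hasEq L' ≡ true → Const Θ → Const Θ → Atom L' Θ

_⊨at_ : {L' : StIL} {Θ : Sig} → Structure Θ → Atom L' Θ → Set
S ⊨at atP P ts   = rel S P (map (con S) ts)
S ⊨at atEq _ c d = con S c ≡ con S d

-- 𝓛'-asimulations.  The relation A consists of pairs of kind 1→2
-- (R₁₂) and of kind 2→1 (R₂₁).

AsimRel : {Θ : Sig} (M₁ M₂ : Model Θ) → Set₁
AsimRel M₁ M₂ = ∀ {l} (w : W M₁) → Vec (Dm M₁ w) l → (v : W M₂) → Vec (Dm M₂ v) l → Set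

record AsimCond {Θ : Sig} (L' : StIL) (Mi Mj : Model Θ)
       (Rij : AsimRel Mi Mj) (Rji : AsimRel Mj Mi)
       {l : ℕ} (w : W Mi) (ᾱ : Vec (Dm Mi w) l) (v : W Mj) (β̄ : Vec (Dm Mj v) l) : Set where
  field
    atoms : ∀ (φ : Atom L' (Θ ⊕ l)) →
            expS (𝔄 Mi w) ᾱ ⊨at φ → expS (𝔄 Mj v) β̄ ⊨at φ
    back  : ∀ t (q : _≺_ Mj v t) → Σ (W Mi) λ u → Σ (_≺_ Mi w u) λ p →
            Rij u (map (H Mi p) ᾱ) t (map (H Mj q) β̄) ×
            Rji t (map (H Mj q) β̄) u (map (H Mi p) ᾱ)
    forth-el : ∀ (α' : Dm Mi w) → Σ (Dm Mj v) λ β' → Rij w (ᾱ ∷ʳ α') v (β̄ ∷ʳ β')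
    back-el  : ∀ t (q : _≺_ Mj v t) (β' : Dm Mj t) →
               Σ (W Mi) λ u → Σ (_≺_ Mi w u) λ p → Σ (Dm Mi u) λ α' →
               Rij u (map (H Mi p) ᾱ ∷ʳ α') t (map (H Mj q) β̄ ∷ʳ β')

record Asim {Θ : Sig} (L' : StIL) (M₁ M₂ : Model Θ) (w₁ : W M₁) (w₂ : W M₂)
            {n : ℕ} (ā : Vec (Dm M₁ w₁) n) (b̄ : Vec (Dm M₂ w₂) n) : Set₁ where
  field
    R₁₂   : AsimRel M₁ M₂
    R₂₁   : AsimRel M₂ M₁
    init  : R₁₂ w₁ ā w₂ b̄
    cond₁₂ : ∀ {l} w (ᾱ : Vec (Dm M₁ w) l) v β̄ → R₁₂ w ᾱ v β̄ → AsimCond L' M₁ M₂ R₁₂ R₂₁ w ᾱ v β̄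
    cond₂₁ : ∀ {l} w (ᾱ : Vec (Dm M₂ w) l) v β̄ → R₂₁ w ᾱ v β̄ → AsimCond L' M₂ M₁ R₂₁ R₁₂ w ᾱ v β̄
open Asim public

record AbsIntLogic : Set₂ where
  field
    Str  : (Θ : Sig) (M : Model Θ) → W M → Set
    Sen  : Sig → Set
    Sat  : {Θ : Sig} (M : Model Θ) (w : W M) → Sen Θ → Set

    str-iso    : ∀ {Θ} {M N : Model Θ} {w} (i : Iso M N) → Str Θ M w → Str Θ N (f i w)
    str-point  : ∀ {Θ} {M : Model Θ} {w} (v : W M) → Str Θ M w → Str Θ M v
    str-reduct : ∀ {Θ' Θ} (σ : SigMor Θ' Θ) {M : Model Θ} {w} → Str Θ M w → Str Θ' (reduct σ M) w
    str-const  : ∀ {Θ} {M : Model Θ} {w} {n} (ā : Vec (Dm M w) n) →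
                 Str Θ M w → Str (Θ ⊕ n) (expand M w ā) (base M w ā)

    sat-iso : ∀ {Θ} {M N : Model Θ} {w} (i : Iso M N) (φ : Sen Θ) → Str Θ M w →
              Sat M w φ ⇔ Sat N (f i w) φ
    trans-sen : ∀ {Θ' Θ} → SigMor Θ' Θ → Sen Θ' → Sen Θ
    sat-trans : ∀ {Θ' Θ} (σ : SigMor Θ' Θ) {M : Model Θ} {w} (φ : Sen Θ') → Str Θ M w →
                Sat M w (trans-sen σ φ) ⇔ Sat (reduct σ M) w φ

    ⊥L  : ∀ {Θ} → Sen Θ
    _⇒L_ _∧L_ _∨L_ : ∀ {Θ} → Sen Θ → Sen Θ → Sen Θ
    ∃L ∀L : ∀ {Θ} → Sen (Θ ⊕ 1) → Sen Θ
    sat-⊥ : ∀ {Θ} {M : Model Θ} {w} → Str Θ M w → Sat M w ⊥L ⇔ ⊥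
    sat-⇒ : ∀ {Θ} {M : Model Θ} {w} φ ψ → Str Θ M w →
            Sat M w (φ ⇒L ψ) ⇔ (∀ v → _≺_ M w v → Sat M v φ → Sat M v ψ)
    sat-∧ : ∀ {Θ} {M : Model Θ} {w} φ ψ → Str Θ M w →
            Sat M w (φ ∧L ψ) ⇔ (Sat M w φ × Sat M w ψ)
    sat-∨ : ∀ {Θ} {M : Model Θ} {w} φ ψ → Str Θ M w →
            Sat M w (φ ∨L ψ) ⇔ (Sat M w φ ⊎ Sat M w ψ)
    sat-∃ : ∀ {Θ} {M : Model Θ} {w} φ → Str Θ M w →
            Sat M w (∃L φ) ⇔ (Σ (Dm M w) λ a → Sat (expand M w (a ∷ [])) (base M w (a ∷ [])) φ)
    sat-∀ : ∀ {Θ} {M : Model Θ} {w} φ → Str Θ M w →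
            Sat M w (∀L φ) ⇔ (∀ v → _≺_ M w v → ∀ (a : Dm M v) →
                               Sat (expand M v (a ∷ [])) (base M v (a ∷ [])) φ)
open AbsIntLogic public

Preserved : AbsIntLogic → StIL → Set₁
Preserved 𝓛 L' = ∀ (Θ : Sig) (M₁ : Model Θ) (w₁ : W M₁) (M₂ : Model Θ) (w₂ : W M₂) →
  Str 𝓛 Θ M₁ w₁ → Str 𝓛 Θ M₂ w₂ →
  Asim L' M₁ M₂ w₁ w₂ [] [] →
  ∀ (φ : Sen 𝓛 Θ) → Sat 𝓛 M₁ w₁ φ → Sat 𝓛 M₂ w₂ φ

Tp⁺ : (𝓛 : AbsIntLogic) {Θ : Sig} {n : ℕ} (M : Model Θ) (w : W M) →
      Vec (Dm M w) n → Sen 𝓛 (Θ ⊕ n) → Set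
Tp⁺ 𝓛 M w ā φ = Sat 𝓛 (expand M w ā) (base M w ā) φ

{-# OPTIONS --safe #-}
-- Expanding both models by the constants c̄ₙ turns A into an asimulation
-- between ([M,w], c̄/ā) and ([N,v], c̄/b̄) from the empty tuples: relate
-- (u;γ) to (t;δ) when (u; H_{wu}ā ⌢ γ) A (t; H_{vt}b̄ ⌢ δ).  An atom over
-- (Θ ∪ c̄ₙ) ∪ c̄ₗ is an atom over Θ ∪ c̄ₙ₊ₗ after renaming its constants,
-- so the atomic clause transfers, and the other clauses hold because the
-- homomorphisms compose.  Preservation under asimulations then applies.
module Submission where

open import Defs
open import Data.Nat using (ℕ; _+_)
open import Data.Vec using (Vec; []; _∷_; map; _∷ʳ_; _++_)
open import Data.Vec.Properties using (map-++; map-cong; map-∘; lookup-map; lookup-++ˡ; lookup-++ʳ)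
open import Data.Fin using (_↑ˡ_; _↑ʳ_)
open import Data.Sum using (inj₁; inj₂)
open import Data.Product using (Σ; _×_; _,_)
open import Relation.Binary.PropositionalEquality
  using (_≡_; refl; sym; trans; cong; cong₂; subst; subst₂; module ≡-Reasoning)
open ≡-Reasoning

-- A relation on vectors of a common length cannot simply be transported
-- along m + 0 ≡ m or m + suc l ≡ suc (m + l), hence these inductions.

++-identityʳ-resp : {A B : Set} (F : ∀ {k} → Vec A k → Vec B k → Set) {m : ℕ}
                    (xs : Vec A m) (ys : Vec B m) → F xs ys → F (xs ++ []) (ys ++ [])
++-identityʳ-resp F []       []       f = f
++-identityʳ-resp F (x ∷ xs) (y ∷ ys) f =
  ++-identityʳ-resp (λ as bs → F (x ∷ as) (y ∷ bs)) xs ys f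

++-∷ʳ-resp : {A B : Set} (F : ∀ {k} → Vec A k → Vec B k → Set) {m l : ℕ}
             (xs : Vec A m) (xs' : Vec B m) (ys : Vec A l) (ys' : Vec B l) (a : A) (b : B) →
             F ((xs ++ ys) ∷ʳ a) ((xs' ++ ys') ∷ʳ b) → F (xs ++ (ys ∷ʳ a)) (xs' ++ (ys' ∷ʳ b))
++-∷ʳ-resp F []       []         ys ys' a b f = f
++-∷ʳ-resp F (x ∷ xs) (x' ∷ xs') ys ys' a b f =
  ++-∷ʳ-resp (λ as bs → F (x ∷ as) (x' ∷ bs)) xs xs' ys ys' a b f

module _ {Θ : Sig} where

  flattenConst : {n l : ℕ} → Const ((Θ ⊕ n) ⊕ l) → Const (Θ ⊕ (n + l))
  flattenConst         (inj₁ (inj₁ c)) = inj₁ c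
  flattenConst {l = l} (inj₁ (inj₂ i)) = inj₂ (i ↑ˡ l)
  flattenConst {n = n} (inj₂ j)        = inj₂ (n ↑ʳ j)

  flattenAtom : {L' : StIL} {n l : ℕ} → Atom L' ((Θ ⊕ n) ⊕ l) → Atom L' (Θ ⊕ (n + l))
  flattenAtom (atP P ts)   = atP P (map flattenConst ts)
  flattenAtom (atEq e c d) = atEq e (flattenConst c) (flattenConst d)

  map-H-id : (M : Model Θ) {w : W M} {n : ℕ} (p : _≺_ M w w) (ā : Vec (Dm M w) n) →
             ā ≡ map (H M p) ā
  map-H-id M p []      = refl
  map-H-id M p (x ∷ ā) = cong₂ _∷_ (sym (H-id M p x)) (map-H-id M p ā)

  map-H-++ : (M : Model Θ) {w u u' : W M} {n l : ℕ} (ā : Vec (Dm M w) n)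
             (p : _≺_ M w u) (p' : _≺_ M u u') (r : _≺_ M w u') (γ : Vec (Dm M u) l) →
             map (H M p') (map (H M p) ā ++ γ) ≡ map (H M r) ā ++ map (H M p') γ
  map-H-++ M ā p p' r γ = begin
    map (H M p') (map (H M p) ā ++ γ)           ≡⟨ map-++ (H M p') (map (H M p) ā) γ ⟩
    map (H M p') (map (H M p) ā) ++ map (H M p') γ
      ≡⟨ cong (_++ map (H M p') γ) (sym (map-∘ (H M p') (H M p) ā)) ⟩
    map (λ x → H M p' (H M p x)) ā ++ map (H M p') γ
      ≡⟨ cong (_++ map (H M p') γ) (sym (map-cong (H-comp M p p' r) ā)) ⟩
    map (H M r) ā ++ map (H M p') γ             ∎

  -- Seen from u ≻ w, the constants c̄ₙ of ([M,w], c̄/ā) denote H_{wu}ā.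
  module _ (M : Model Θ) (w : W M) {n : ℕ} (ā : Vec (Dm M w) n)
           (u : W M) (p : _≺_ M w u) {l : ℕ} (γ : Vec (Dm M u) l) where

    private
      Nested Flat : Structure _
      Nested = expS (𝔄 (expand M w ā) (u , p)) γ
      Flat   = expS (𝔄 M u) (map (H M p) ā ++ γ)

    con-flattenConst : ∀ c → con Nested c ≡ con Flat (flattenConst c)
    con-flattenConst (inj₁ (inj₁ c)) = refl
    con-flattenConst (inj₁ (inj₂ i)) =
      sym (trans (lookup-++ˡ (map (H M p) ā) γ i) (lookup-map i (H M p) ā))
    con-flattenConst (inj₂ j) = sym (lookup-++ʳ (map (H M p) ā) γ j)

    private
      map-con-flattenConst : ∀ {k} (ts : Vec (Const ((Θ ⊕ n) ⊕ l)) k) →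
                             map (con Nested) ts ≡ map (con Flat) (map flattenConst ts)
      map-con-flattenConst ts =
        trans (map-cong con-flattenConst ts) (map-∘ (con Flat) flattenConst ts)

    ⊨at-flatten⁺ : {L' : StIL} (φ : Atom L' ((Θ ⊕ n) ⊕ l)) →
                   Nested ⊨at φ → Flat ⊨at flattenAtom φ
    ⊨at-flatten⁺ (atP P ts)   h = subst (rel (𝔄 M u) P) (map-con-flattenConst ts) h
    ⊨at-flatten⁺ (atEq e c d) h =
      trans (sym (con-flattenConst c)) (trans h (con-flattenConst d))

    ⊨at-flatten⁻ : {L' : StIL} (φ : Atom L' ((Θ ⊕ n) ⊕ l)) →
                   Flat ⊨at flattenAtom φ → Nested ⊨at φ
    ⊨at-flatten⁻ (atP P ts)   h = subst (rel (𝔄 M u) P) (sym (map-con-flattenConst ts)) h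
    ⊨at-flatten⁻ (atEq e c d) h =
      trans (con-flattenConst c) (trans h (sym (con-flattenConst d)))

  expandRel : (Mi : Model Θ) (wi : W Mi) (Mj : Model Θ) (wj : W Mj) {n : ℕ}
              (ā : Vec (Dm Mi wi) n) (b̄ : Vec (Dm Mj wj) n) →
              AsimRel Mi Mj → AsimRel (expand Mi wi ā) (expand Mj wj b̄)
  expandRel Mi wi Mj wj ā b̄ R (u , p) γ (t , q) δ =
    R u (map (H Mi p) ā ++ γ) t (map (H Mj q) b̄ ++ δ)

  module ExpandCond (L' : StIL) (Mi : Model Θ) (wi : W Mi) (Mj : Model Θ) (wj : W Mj) {n : ℕ}
    (ā : Vec (Dm Mi wi) n) (b̄ : Vec (Dm Mj wj) n) (Rij : AsimRel Mi Mj) (Rji : AsimRel Mj Mi)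
    {l : ℕ} (u : W Mi) (p : _≺_ Mi wi u) (γ : Vec (Dm Mi u) l)
            (t : W Mj) (q : _≺_ Mj wj t) (δ : Vec (Dm Mj t) l)
    (C : AsimCond L' Mi Mj Rij Rji u (map (H Mi p) ā ++ γ) t (map (H Mj q) b̄ ++ δ)) where

    private
      Mi' = expand Mi wi ā
      Mj' = expand Mj wj b̄
      Rij' = expandRel Mi wi Mj wj ā b̄ Rij
      Rji' = expandRel Mj wj Mi wi b̄ ā Rji
      open AsimCond C

    atoms' : ∀ φ → expS (𝔄 Mi' (u , p)) γ ⊨at φ → expS (𝔄 Mj' (t , q)) δ ⊨at φ
    atoms' φ h =
      ⊨at-flatten⁻ Mj wj b̄ t q δ φ (atoms (flattenAtom φ) (⊨at-flatten⁺ Mi wi ā u p γ φ h))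

    back' : ∀ y (q' : _≺_ Mj' (t , q) y) → Σ (W Mi') λ x → Σ (_≺_ Mi' (u , p) x) λ p' →
            Rij' x (map (H Mi p') γ) y (map (H Mj q') δ) ×
            Rji' y (map (H Mj q') δ) x (map (H Mi p') γ)
    back' (t' , q'') q' with back t' q'
    ... | u' , p' , r₁₂ , r₂₁ =
      (u' , ≺-trans Mi p p') , p' ,
      subst₂ (λ xs ys → Rij u' xs t' ys) eqᵢ eqⱼ r₁₂ ,
      subst₂ (λ ys xs → Rji t' ys u' xs) eqⱼ eqᵢ r₂₁
      where
      eqᵢ = map-H-++ Mi ā p p' (≺-trans Mi p p') γ
      eqⱼ = map-H-++ Mj b̄ q q' q'' δ

    forth-el' : ∀ α' → Σ (Dm Mj t) λ β' → Rij' (u , p) (γ ∷ʳ α') (t , q) (δ ∷ʳ β')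
    forth-el' α' with forth-el α'
    ... | β' , r =
      β' , ++-∷ʳ-resp (λ xs ys → Rij u xs t ys) (map (H Mi p) ā) (map (H Mj q) b̄) γ δ α' β' r

    back-el' : ∀ y (q' : _≺_ Mj' (t , q) y) (β' : Dm Mj' y) →
               Σ (W Mi') λ x → Σ (_≺_ Mi' (u , p) x) λ p' → Σ (Dm Mi' x) λ α' →
               Rij' x (map (H Mi p') γ ∷ʳ α') y (map (H Mj q') δ ∷ʳ β')
    back-el' (t' , q'') q' β' with back-el t' q' β'
    ... | u' , p' , α' , r =
      (u' , ≺-trans Mi p p') , p' , α' ,
      ++-∷ʳ-resp (λ xs ys → Rij u' xs t' ys) (map (H Mi (≺-trans Mi p p')) ā) (map (H Mj q'') b̄)
        (map (H Mi p') γ) (map (H Mj q') δ) α' β'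
        (subst₂ (λ xs ys → Rij u' (xs ∷ʳ α') t' (ys ∷ʳ β'))
                (map-H-++ Mi ā p p' (≺-trans Mi p p') γ) (map-H-++ Mj b̄ q q' q'' δ) r)

    asimCond : AsimCond L' Mi' Mj' Rij' Rji' (u , p) γ (t , q) δ
    asimCond = record { atoms = atoms' ; back = back' ; forth-el = forth-el' ; back-el = back-el' }

  expandAsim : {L' : StIL} (M : Model Θ) (w : W M) (N : Model Θ) (v : W N) {n : ℕ}
               (ā : Vec (Dm M w) n) (b̄ : Vec (Dm N v) n) →
               Asim L' M N w v ā b̄ →
               Asim L' (expand M w ā) (expand N v b̄) (base M w ā) (base N v b̄) [] []
  expandAsim {L'} M w N v ā b̄ A = record
    { R₁₂    = expandRel M w N v ā b̄ (R₁₂ A)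
    ; R₂₁    = expandRel N v M w b̄ ā (R₂₁ A)
    ; init   = ++-identityʳ-resp (λ xs ys → R₁₂ A w xs v ys) _ _
                 (subst₂ (λ xs ys → R₁₂ A w xs v ys)
                         (map-H-id M (≺-refl M) ā) (map-H-id N (≺-refl N) b̄) (init A))
    ; cond₁₂ = λ { (u , p) γ (t , q) δ r →
        ExpandCond.asimCond L' M w N v ā b̄ (R₁₂ A) (R₂₁ A) u p γ t q δ (cond₁₂ A u _ t _ r) }
    ; cond₂₁ = λ { (u , p) γ (t , q) δ r →
        ExpandCond.asimCond L' N v M w b̄ ā (R₂₁ A) (R₁₂ A) u p γ t q δ (cond₂₁ A u _ t _ r) }
    }

lemma4p6 : (𝓛 : AbsIntLogic) (L' : StIL) → Preserved 𝓛 L' →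
    (Θ : Sig) (M : Model Θ) (w : W M) (N : Model Θ) (v : W N) →
    Str 𝓛 Θ M w → Str 𝓛 Θ N v →
    (n : ℕ) (ā : Vec (Dm M w) n) (b̄ : Vec (Dm N v) n) →
    Asim L' M N w v ā b̄ →
    ∀ (φ : Sen 𝓛 (Θ ⊕ n)) → Tp⁺ 𝓛 M w ā φ → Tp⁺ 𝓛 N v b̄ φ
lemma4p6 𝓛 L' preserved Θ M w N v strM strN n ā b̄ A =
  preserved (Θ ⊕ n) (expand M w ā) (base M w ā) (expand N v b̄) (base N v b̄)
            (str-const 𝓛 ā strM) (str-const 𝓛 b̄ strN) (expandAsim M w N v ā b̄ A)
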